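{- Let $G$ be a connected graph. Then $pd_s(G)=2$ if and only if $G$ is a path.
   Context: Graphs are finite, simple, connected (with at least two vertices so that partitions into two nonempty sets exist); $d_G$ is shortest-path distance, $d_G(x,W)=\min\{d_G(x,w):w\in W\}$. A set $W$ strongly resolves different vertices $x,y\notin W$ if $d_G(x,W)=d_G(x,y)+d_G(y,W)$ or $d_G(y,W)=d_G(y,x)+d_G(x,W)$. A vertex partition $\Pi$ is a strong resolving partition if every two different vertices in the same set of $\Pi$ are strongly resolved by some set of $\Pi$; the strong partition dimension $pd_s(G)$ is the minimum cardinality of such a partition (always at least $2$). -}

module Defs where

open import Data.Nat using (ℕ; zero; suc; _+_; _<_; _⊔_; _⊓_)
open import Data.Fin using (Fin; toℕ; _≟_)
open import Data.Bool using (Bool; true; false; _∨_; _∧_; if_then_else_)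
open import Data.List using (List; allFin; foldr)
open import Data.Bool.ListAction using (any)
open import Data.Product using (Σ; ∃; _×_; _,_)
open import Data.Sum using (_⊎_)
open import Relation.Binary.PropositionalEquality using (_≡_; _≢_)
open import Relation.Nullary.Decidable using (⌊_⌋)
open import Relation.Nullary using (¬_)
open import Function.Bundles using (_⇔_; _↔_; Inverse)

record Graph (n : ℕ) : Set where
  field
    adj   : Fin n → Fin n → Bool
    sym   : ∀ x y → adj x y ≡ adj y x
    loopless : ∀ x → adj x x ≡ false
open Graph public

Adj : ∀ {n} → Graph n → Fin n → Fin n → Set
Adj G x y = adj G x y ≡ true

data Walk {n} (G : Graph n) : Fin n → Fin n → ℕ → Set where
  [] : ∀ {x} → Walk G x x zero
  _∷_ : ∀ {x y z k} → Adj G x y → Walk G y z k → Walk G x z (suc k)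

Connected : ∀ {n} → Graph n → Set
Connected G = ∀ x y → ∃ λ k → Walk G x y k

ball : ∀ {n} → Graph n → ℕ → Fin n → Fin n → Bool
ball G zero    x y = ⌊ x ≟ y ⌋
ball {n} G (suc k) x y = ball G k x y ∨ any (λ z → ball G k x z ∧ adj G z y) (allFin n)

-- least k < b with p k = true, or b if there is none
firstTrue : ℕ → (ℕ → Bool) → ℕ
firstTrue zero    p = zero
firstTrue (suc b) p = if p zero then zero else suc (firstTrue b (λ k → p (suc k)))

-- Shortest-path distance d_G(x,y): the least k such that there is a walk of
-- length ≤ k from x to y (searched for k < n; in a connected graph on n
-- vertices every distance is < n).
dist : ∀ {n} → Graph n → Fin n → Fin n → ℕ
dist {n} G x y = firstTrue n (λ k → ball G k x y)

VSet : ℕ → Set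
VSet n = Fin n → Bool

-- d_G(x,W) = min { d_G(x,w) : w ∈ W } (only used for nonempty W; for the
-- empty set it returns n, which never occurs below).
distSet : ∀ {n} → Graph n → Fin n → VSet n → ℕ
distSet {n} G x W = foldr (λ w m → if W w then dist G x w ⊓ m else m) n (allFin n)

StronglyResolves : ∀ {n} → Graph n → VSet n → Fin n → Fin n → Set
StronglyResolves G W x y =
  W x ≡ false × W y ≡ false ×
  (distSet G x W ≡ dist G x y + distSet G y W ⊎
   distSet G y W ≡ dist G y x + distSet G x W)

-- A partition of the vertex set into k nonempty classes, given by the
-- class-assignment map f (class i is { v | f v ≡ i }); surjectivity of f
-- expresses that the classes are nonempty.
record Partition {n} (G : Graph n) (k : ℕ) : Set where
  field
    cls  : Fin n → Fin k
    onto : ∀ i → ∃ λ v → cls v ≡ i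
open Partition public

classSet : ∀ {n k} {G : Graph n} → Partition G k → Fin k → VSet n
classSet P i v = ⌊ cls P v ≟ i ⌋

IsStrongResolvingPartition : ∀ {n k} (G : Graph n) → Partition G k → Set
IsStrongResolvingPartition {k = k} G P =
  ∀ x y → x ≢ y → cls P x ≡ cls P y →
    ∃ λ (i : Fin k) → StronglyResolves G (classSet P i) x y

HasSRP : ∀ {n} → Graph n → ℕ → Set
HasSRP G k = Σ (Partition G k) λ P → IsStrongResolvingPartition G P

PdsEq : ∀ {n} → Graph n → ℕ → Set
PdsEq G m = HasSRP G m × (∀ k → k < m → ¬ HasSRP G k)

PathAdj : ∀ {n} → Fin n → Fin n → Set
PathAdj i j = suc (toℕ i) ≡ toℕ j ⊎ suc (toℕ j) ≡ toℕ i

IsPath : ∀ {n} → Graph n → Set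
IsPath {n} G = Σ (Fin n ↔ Fin n) λ σ →
  ∀ i j → Adj G (Inverse.to σ i) (Inverse.to σ j) ⇔ PathAdj i j

module Submission where

-- For a strong resolving partition {A,B} let δ x be the
--    distance from x to the class not containing x.  Two vertices of one
--    class can only be resolved by the other class, which forces
--    δ x = d(x,y) + δ y or the symmetric identity.  For e with δ e maximal,
--    d(e,x) = δ e - δ x on the class of e and d(e,x) = δ e + δ x - 1 on the
--    other class, so the distance profile d(e,·) is injective.
-- 4. A connected graph with an injective distance profile d(e,·) is a path:
--    the profile is a bijection onto 0..n-1, and x ~ y iff the profile
--    values differ by one.
-- 5. Conversely, numbering a path, d(x,y) = |pos x - pos y|, so the
--    partition {start vertex} ∪ {the rest} is strongly resolving.

open import Defs hiding (sym)
open import Data.Nat using (ℕ; zero; suc; _+_; _∸_; _⊓_; _≤_; _<_; z≤n; s≤s; s≤s⁻¹)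
open import Data.Nat.Properties hiding (_≟_)
open import Data.Nat.Induction using (<-rec)
open import Data.Fin using (Fin; toℕ; fromℕ<; punchOut; _≟_) renaming (zero to fz; suc to fs)
import Data.Fin.Properties as Fin
open import Data.Bool using (Bool; true; false; T; if_then_else_)
open import Data.Bool.Properties using (T-≡; T-∨; T-∧)
open import Data.List using (List; []; _∷_; allFin; foldr)
open import Data.List.Membership.Propositional using (_∈_; lose)
open import Data.List.Membership.Propositional.Properties using (∈-allFin)
open import Data.List.Relation.Unary.Any using (here; there; satisfied)
open import Data.List.Relation.Unary.Any.Properties using (any⁺; any⁻)
open import Data.List.Extrema.Nat using (argmax; v≤f[argmax]⁺)
open import Data.Product using (∃; _×_; _,_; proj₁; proj₂)
open import Data.Sum using (_⊎_; inj₁; inj₂)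
import Data.Sum as Sum
open import Data.Empty using (⊥-elim)
open import Function.Definitions using (Injective)
open import Function.Bundles using (_⇔_; _↔_; Inverse; Equivalence; mk↔ₛ′; mk⇔)
open import Relation.Binary.PropositionalEquality
open import Relation.Nullary using (¬_; yes; no; contradiction)
open import Relation.Nullary.Decidable using (toWitness; fromWitness; isYes≗does; dec-true; dec-false)
open import Relation.Binary.Definitions using (tri<; tri≈; tri>)

firstTrue-≤ : ∀ b p → firstTrue b p ≤ b
firstTrue-≤ zero    p = z≤n
firstTrue-≤ (suc b) p with p zero
... | true  = z≤n
... | false = s≤s (firstTrue-≤ b (λ k → p (suc k)))

firstTrue-least : ∀ b p j → T (p j) → j < b → firstTrue b p ≤ j
firstTrue-least (suc b) p j pj j<b with p zero in p0
... | true = z≤n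
firstTrue-least (suc b) p zero    pj _         | false = ⊥-elim (subst T p0 pj)
firstTrue-least (suc b) p (suc j) pj (s≤s j<b) | false =
  s≤s (firstTrue-least b (λ k → p (suc k)) j pj j<b)

firstTrue-sound : ∀ b p → firstTrue b p < b → T (p (firstTrue b p))
firstTrue-sound (suc b) p lt with p zero in p0
... | true  = subst T (sym p0) _
... | false = firstTrue-sound b (λ k → p (suc k)) (s≤s⁻¹ lt)

minOver : {A : Set} → (A → Bool) → (A → ℕ) → ℕ → List A → ℕ
minOver W g b = foldr (λ w m → if W w then g w ⊓ m else m) b

minOver-≤ : ∀ {A : Set} (W : A → Bool) g b {xs w} → w ∈ xs → W w ≡ true →
  minOver W g b xs ≤ g w
minOver-≤ W g b {w ∷ xs} (here refl) Ww rewrite Ww = m⊓n≤m _ _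
minOver-≤ W g b {v ∷ xs} (there w∈) Ww with W v
... | true  = ≤-trans (m⊓n≤n _ _) (minOver-≤ W g b w∈ Ww)
... | false = minOver-≤ W g b w∈ Ww

minOver-attained : ∀ {A : Set} (W : A → Bool) g b xs →
  minOver W g b xs ≡ b ⊎ ∃ λ w → W w ≡ true × minOver W g b xs ≡ g w
minOver-attained W g b [] = inj₁ refl
minOver-attained W g b (w ∷ xs) with W w in Ww
... | false = minOver-attained W g b xs
... | true with ⊓-sel (g w) (minOver W g b xs)
...   | inj₁ eq = inj₂ (w , Ww , eq)
...   | inj₂ eq rewrite eq = minOver-attained W g b xs

injective⇒surjective : ∀ {n} (f : Fin n → Fin n) → Injective _≡_ _≡_ f →
  ∀ i → ∃ λ x → f x ≡ i
injective⇒surjective {suc m} f f-inj i with Fin.any? (λ x → f x Fin.≟ i)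
... | yes hit = hit
... | no miss = contradiction (Fin.injective⇒≤ g-inj) (<-irrefl refl)
  where
    g : Fin (suc m) → Fin m
    g x = punchOut {i = i} {j = f x} (λ eq → miss (x , sym eq))
    g-inj : Injective _≡_ _≡_ g
    g-inj {x} {y} eq = f-inj (Fin.punchOut-injective
      (λ e → miss (x , sym e)) (λ e → miss (y , sym e)) eq)

module Walks {n : ℕ} (G : Graph n) where

  adj-sym : ∀ {x y} → Adj G x y → Adj G y x
  adj-sym {x} {y} a = trans (Graph.sym G y x) a

  no-self-loop : ∀ v → ¬ Adj G v v
  no-self-loop v a with () ← trans (sym a) (loopless G v)

  _++ʷ_ : ∀ {x y z i j} → Walk G x y i → Walk G y z j → Walk G x z (i + j)
  []      ++ʷ w′ = w′
  (a ∷ w) ++ʷ w′ = a ∷ (w ++ʷ w′)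

  snoc : ∀ {x y z k} → Walk G x y k → Adj G y z → Walk G x z (suc k)
  snoc []      b = b ∷ []
  snoc (a ∷ w) b = a ∷ snoc w b

  unsnoc : ∀ {x y k} → Walk G x y (suc k) → ∃ λ z → Walk G x z k × Adj G z y
  unsnoc (a ∷ []) = _ , [] , a
  unsnoc (a ∷ (b ∷ w)) with unsnoc (b ∷ w)
  ... | z , w′ , c = z , a ∷ w′ , c

  reverse : ∀ {x y k} → Walk G x y k → Walk G y x k
  reverse []      = []
  reverse (a ∷ w) = snoc (reverse w) (adj-sym a)

  vertexAt : ∀ {x y k} → Walk G x y k → ℕ → Fin n
  vertexAt {x} w       zero    = x
  vertexAt {x} []      (suc t) = x
  vertexAt     (a ∷ w) (suc t) = vertexAt w t

  suffix : ∀ {x y k} (w : Walk G x y k) j → j ≤ k → Walk G (vertexAt w j) y (k ∸ j)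
  suffix w       zero    _         = w
  suffix (a ∷ w) (suc j) (s≤s j≤k) = suffix w j j≤k

  shortcut : ∀ {x y k} (w : Walk G x y k) i j → i < j → j ≤ k →
    vertexAt w i ≡ vertexAt w j → ∃ λ k′ → k′ < k × Walk G x y k′
  shortcut {y = y} {k} w zero j i<j j≤k eq =
    k ∸ j , ∸-monoʳ-< i<j j≤k , subst (λ v → Walk G v y (k ∸ j)) (sym eq) (suffix w j j≤k)
  shortcut (a ∷ w) (suc i) (suc j) (s≤s i<j) (s≤s j≤k) eq with shortcut w i j i<j j≤k eq
  ... | k′ , k′<k , w′ = suc k′ , s≤s k′<k , a ∷ w′

  -- A walk with at least n edges repeats one of its first n+1 vertices.
  shorten-once : ∀ {x y k} → n ≤ k → Walk G x y k → ∃ λ k′ → k′ < k × Walk G x y k′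
  shorten-once n≤k w with Fin.pigeonhole (s≤s n≤k) (λ t → vertexAt w (toℕ t))
  ... | i , j , i<j , eq = shortcut w (toℕ i) (toℕ j) i<j (s≤s⁻¹ (Fin.toℕ<n j)) eq

  ShortWalk : Fin n → Fin n → Set
  ShortWalk x y = ∃ λ k → k < n × Walk G x y k

  shorten : ∀ {x y} k → Walk G x y k → ShortWalk x y
  shorten {x} {y} = <-rec (λ k → Walk G x y k → ShortWalk x y) step
    where
      step : ∀ k → (∀ {j} → j < k → Walk G x y j → ShortWalk x y) → Walk G x y k → ShortWalk x y
      step k rec w with n ≤? k
      ... | no n≰k = k , ≰⇒> n≰k , w
      ... | yes n≤k with shorten-once n≤k w
      ...   | k′ , k′<k , w′ = rec k′<k w′

  ball-sound : ∀ k {x y} → T (ball G k x y) → ∃ λ j → j ≤ k × Walk G x y j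
  ball-sound zero t with refl ← toWitness t = 0 , z≤n , []
  ball-sound (suc k) t with Equivalence.to T-∨ t
  ... | inj₁ t′ with ball-sound k t′
  ...   | j , j≤k , w = j , m≤n⇒m≤1+n j≤k , w
  ball-sound (suc k) t | inj₂ t′ with satisfied (any⁻ _ (allFin n) t′)
  ... | z , t″ with Equivalence.to T-∧ t″
  ... | tz , a with ball-sound k tz
  ... | j , j≤k , w = suc j , s≤s j≤k , snoc w (Equivalence.to T-≡ a)

  ball-complete : ∀ k {x y j} → Walk G x y j → j ≤ k → T (ball G k x y)
  ball-complete zero [] z≤n = fromWitness refl
  ball-complete (suc k) w j≤1+k with m≤n⇒m<n∨m≡n j≤1+k
  ... | inj₁ (s≤s j≤k) = Equivalence.from T-∨ (inj₁ (ball-complete k w j≤k))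
  ... | inj₂ refl with unsnoc w
  ... | z , w′ , a = Equivalence.from T-∨ (inj₂ (any⁺ _ (lose (∈-allFin z)
          (Equivalence.from T-∧ (ball-complete k w′ ≤-refl , Equivalence.from T-≡ a)))))

  dist-≤ : ∀ {x y j} → Walk G x y j → dist G x y ≤ j
  dist-≤ {j = j} w with j <? n
  ... | yes j<n = firstTrue-least n _ j (ball-complete j w ≤-refl) j<n
  ... | no j≮n  = ≤-trans (firstTrue-≤ n _) (≮⇒≥ j≮n)

module Metric {n : ℕ} (G : Graph n) (conn : Connected G) where
  open Walks G

  dist<n : ∀ x y → dist G x y < n
  dist<n x y with shorten _ (proj₂ (conn x y))
  ... | k , k<n , w = ≤-<-trans (dist-≤ w) k<n

  geodesic : ∀ x y → Walk G x y (dist G x y)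
  geodesic x y with ball-sound _ (firstTrue-sound n (λ k → ball G k x y) (dist<n x y))
  ... | j , j≤d , w = subst (Walk G x y) (≤-antisym j≤d (dist-≤ w)) w

  dist-sym : ∀ x y → dist G x y ≡ dist G y x
  dist-sym x y = ≤-antisym (dist-≤ (reverse (geodesic y x))) (dist-≤ (reverse (geodesic x y)))

  dist-triangle : ∀ x y z → dist G x z ≤ dist G x y + dist G y z
  dist-triangle x y z = dist-≤ (geodesic x y ++ʷ geodesic y z)

  dist-self : ∀ x → dist G x x ≡ 0
  dist-self x = n≤0⇒n≡0 (dist-≤ [])

  dist≡0⇒≡ : ∀ {x y} → dist G x y ≡ 0 → x ≡ y
  dist≡0⇒≡ {x} {y} d≡0 with subst (Walk G x y) d≡0 (geodesic x y)
  ... | [] = refl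

  dist-adj : ∀ {x y} → Adj G x y → dist G x y ≤ 1
  dist-adj a = dist-≤ (a ∷ [])

  predecessor : ∀ e y k → dist G e y ≡ suc k → ∃ λ z → Adj G z y × dist G e z ≡ k
  predecessor e y k eq with subst (Walk G y e) eq (reverse (geodesic e y))
  ... | _∷_ {y = z} a w = z , adj-sym a , trans (dist-sym e z) (≤-antisym (dist-≤ w) k≤)
    where
      k≤ : k ≤ dist G z e
      k≤ = s≤s⁻¹ (subst (_≤ suc (dist G z e)) (trans (dist-sym y e) eq) (dist-≤ (a ∷ geodesic z e)))

  distSet-≤ : ∀ x W {w} → W w ≡ true → distSet G x W ≤ dist G x w
  distSet-≤ x W Ww = minOver-≤ W (dist G x) n (∈-allFin _) Ww

  distSet-attained : ∀ x W {w₀} → W w₀ ≡ true →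
    ∃ λ w → W w ≡ true × distSet G x W ≡ dist G x w
  distSet-attained x W {w₀} Ww₀ with minOver-attained W (dist G x) n (allFin n)
  ... | inj₂ attained = attained
  ... | inj₁ eq = contradiction (subst (_≤ dist G x w₀) eq (distSet-≤ x W Ww₀)) (<⇒≱ (dist<n x w₀))

module Classes {n k : ℕ} {G : Graph n} (P : Partition G k) where

  ∈class : ∀ {w i} → cls P w ≡ i → classSet P i w ≡ true
  ∈class {w} {i} eq = trans (isYes≗does (cls P w ≟ i)) (dec-true (cls P w ≟ i) eq)

  ∉class : ∀ {w i} → cls P w ≢ i → classSet P i w ≡ false
  ∉class {w} {i} ne = trans (isYes≗does (cls P w ≟ i)) (dec-false (cls P w ≟ i) ne)

  ∈class⁻ : ∀ {w i} → classSet P i w ≡ true → cls P w ≡ i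
  ∈class⁻ w∈ = toWitness (Equivalence.from T-≡ w∈)

  ∉class⁻ : ∀ {w i} → classSet P i w ≡ false → cls P w ≢ i
  ∉class⁻ w∉ eq with () ← trans (sym w∉) (∈class eq)

other : Fin 2 → Fin 2
other fz      = fs fz
other (fs fz) = fz

other-≢ : ∀ c → c ≢ other c
other-≢ fz      ()
other-≢ (fs fz) ()

≢⇒other : ∀ {a c : Fin 2} → a ≢ c → a ≡ other c
≢⇒other {fz}    {fz}    ne = contradiction refl ne
≢⇒other {fz}    {fs fz} ne = refl
≢⇒other {fs fz} {fz}    ne = refl
≢⇒other {fs fz} {fs fz} ne = contradiction refl ne

≢-same : ∀ {a b c : Fin 2} → a ≢ c → b ≢ c → a ≡ b
≢-same a≢c b≢c = trans (≢⇒other a≢c) (sym (≢⇒other b≢c))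

Fin1-≡ : (a b : Fin 1) → a ≡ b
Fin1-≡ fz fz = refl

-- Zero classes cannot label a vertex; with one class,
-- the only candidate resolving set contains the two vertices.

pd-lower : ∀ {m} (G : Graph (suc (suc m))) → ∀ k → k < 2 → ¬ HasSRP G k
pd-lower G zero          _ (P , _) with () ← cls P fz
pd-lower G (suc zero)    _ (P , srp) with srp fz (fs fz) (λ ()) (Fin1-≡ _ _)
... | i , fz∉ , _ = Classes.∉class⁻ P fz∉ (Fin1-≡ (cls P fz) i)
pd-lower G (suc (suc k)) (s≤s (s≤s ()))

module TwoClasses {n : ℕ} (G : Graph n) (conn : Connected G) (P : Partition G 2)
                  (srp : IsStrongResolvingPartition G P) where
  open Walks G
  open Metric G conn
  open Classes P

  cl : Fin n → Fin 2
  cl = cls P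

  δ : Fin n → ℕ
  δ x = distSet G x (classSet P (other (cl x)))

  δ-attained : ∀ x → ∃ λ w → cl w ≡ other (cl x) × δ x ≡ dist G x w
  δ-attained x with distSet-attained x _ (∈class (proj₂ (onto P (other (cl x)))))
  ... | w , w∈ , eq = w , ∈class⁻ w∈ , eq

  δ-≤ : ∀ x w → cl w ≢ cl x → δ x ≤ dist G x w
  δ-≤ x w ne = distSet-≤ x _ (∈class (≢⇒other ne))

  δ-positive : ∀ x → 1 ≤ δ x
  δ-positive x with δ-attained x
  ... | w , cw , eq = n≢0⇒n>0 λ δ≡0 →
    other-≢ (cl x) (trans (cong cl (dist≡0⇒≡ (trans (sym eq) δ≡0))) cw)

  -- Two vertices of one class avoid only the other class, so it is the class
  -- resolving them.
  resolved : ∀ x y → x ≢ y → cl x ≡ cl y →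
    δ x ≡ dist G x y + δ y ⊎ δ y ≡ dist G y x + δ x
  resolved x y ne eq with srp x y ne eq
  ... | i , x∉ , _ , r with sym (≢⇒other (λ i≡clx → ∉class⁻ x∉ (sym i≡clx)))
  ... | refl rewrite sym eq = r

  δ-lipschitz : ∀ v w → cl v ≡ cl w → δ v ≤ dist G v w + δ w
  δ-lipschitz v w eq with v ≟ w
  ... | yes refl = m≤n+m _ _
  ... | no ne with resolved v w ne eq
  ...   | inj₁ δv = ≤-reflexive δv
  ...   | inj₂ δw = ≤-trans (m≤n+m (δ v) (dist G w v)) (≤-trans (≤-reflexive (sym δw)) (m≤n+m _ _))

  δ-injective : ∀ x y → cl x ≡ cl y → δ x ≡ δ y → x ≡ y
  δ-injective x y eq δ≡ with x ≟ y
  ... | yes x≡y = x≡y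
  ... | no ne with resolved x y ne eq
  ...   | inj₁ δx = contradiction (dist≡0⇒≡ (+-cancelʳ-≡ (δ y) _ 0 (trans (sym δx) δ≡))) ne
  ...   | inj₂ δy = contradiction (sym (dist≡0⇒≡ (+-cancelʳ-≡ (δ x) _ 0 (trans (sym δy) (sym δ≡))))) ne

  δ-above-boundary : ∀ x w → cl x ≡ cl w → δ w ≤ 1 → dist G x w + 1 ≤ δ x
  δ-above-boundary x w eq δw≤1 with x ≟ w
  ... | yes refl = subst (λ d → d + 1 ≤ δ x) (sym (dist-self x)) (δ-positive x)
  ... | no ne with resolved x w ne eq
  ...   | inj₁ δx = subst (dist G x w + 1 ≤_) (sym δx) (+-monoʳ-≤ (dist G x w) (δ-positive w))
  ...   | inj₂ δw = contradiction (sym (dist≡0⇒≡ (n≤0⇒n≡0 (+-cancelʳ-≤ 1 _ 0 d+1≤1)))) ne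
    where
      d+1≤1 : dist G w x + 1 ≤ 0 + 1
      d+1≤1 = ≤-trans (+-monoʳ-≤ (dist G w x) (δ-positive x)) (subst (_≤ 1) δw δw≤1)

  -- Along a walk between the classes, δ at the two ends sums to at most the
  -- length plus one: the walk crosses between the classes along some edge.
  crossing : ∀ {u v L} → cl u ≢ cl v → Walk G u v L → δ u + δ v ≤ suc L
  crossing ne [] = contradiction refl ne
  crossing {u} {v} {suc L} ne (_∷_ {y = w} a r) with cl w ≟ cl u
  ... | yes same = ≤-trans (+-monoˡ-≤ (δ v) δu≤) (s≤s (crossing (λ q → ne (trans (sym same) q)) r))
    where
      δu≤ : δ u ≤ suc (δ w)
      δu≤ = ≤-trans (δ-lipschitz u w (sym same)) (+-monoˡ-≤ (δ w) (dist-adj a))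
  ... | no differ = +-mono-≤ δu≤1 δv≤
    where
      δu≤1 : δ u ≤ 1
      δu≤1 = ≤-trans (δ-≤ u w differ) (dist-adj a)
      δw≤1 : δ w ≤ 1
      δw≤1 = ≤-trans (δ-≤ w u (λ q → differ (sym q))) (dist-adj (adj-sym a))
      δv≤ : δ v ≤ suc L
      δv≤ = ≤-trans (δ-lipschitz v w (sym (≢-same differ (λ q → ne (sym q)))))
              (≤-trans (+-mono-≤ (≤-trans (≤-reflexive (dist-sym v w)) (dist-≤ r)) δw≤1)
                (≤-reflexive (+-comm L 1)))

  nearest-on-boundary : ∀ x w → cl w ≢ cl x → δ x ≡ dist G x w → δ w ≤ 1
  nearest-on-boundary x w ne δx = +-cancelˡ-≤ (δ x) _ 1 (begin
    δ x + δ w         ≤⟨ crossing (λ q → ne (sym q)) (geodesic x w) ⟩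
    suc (dist G x w)  ≡⟨ cong suc (sym δx) ⟩
    suc (δ x)         ≡⟨ +-comm 1 (δ x) ⟩
    δ x + 1           ∎)
    where open ≤-Reasoning

  module Farthest (e : Fin n) (δ-max : ∀ x → cl e ≡ cl x → δ x ≤ δ e) where

    profile-same : ∀ x → cl x ≡ cl e → dist G e x + δ x ≡ δ e
    profile-same x cx with x ≟ e
    ... | yes x≡e = subst (λ v → dist G e v + δ v ≡ δ e) (sym x≡e) (cong (_+ δ e) (dist-self e))
    ... | no ne with resolved e x (λ q → ne (sym q)) (sym cx)
    ...   | inj₁ δe = sym δe
    ...   | inj₂ δx = contradiction (dist≡0⇒≡ (n≤0⇒n≡0 (+-cancelʳ-≤ (δ e) _ 0 d+δe≤δe))) ne
      where
        d+δe≤δe : dist G x e + δ e ≤ 0 + δ e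
        d+δe≤δe = ≤-trans (≤-reflexive (sym δx)) (δ-max x (sym cx))

    profile-other : ∀ x → cl x ≢ cl e → dist G e x + 1 ≡ δ e + δ x
    profile-other x nx with δ-attained e
    ... | w , cw , δe = ≤-antisym upper lower
      where
        open ≤-Reasoning
        w≢e : cl w ≢ cl e
        w≢e q = other-≢ (cl e) (trans (sym q) cw)
        lower : δ e + δ x ≤ dist G e x + 1
        lower = subst (δ e + δ x ≤_) (+-comm 1 (dist G e x)) (crossing (λ q → nx (sym q)) (geodesic e x))
        upper : dist G e x + 1 ≤ δ e + δ x
        upper = begin
          dist G e x + 1               ≤⟨ +-monoˡ-≤ 1 (dist-triangle e w x) ⟩
          dist G e w + dist G w x + 1  ≡⟨ cong₂ (λ a b → a + b + 1) (sym δe) (dist-sym w x) ⟩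
          δ e + dist G x w + 1         ≡⟨ +-assoc (δ e) _ 1 ⟩
          δ e + (dist G x w + 1)       ≤⟨ +-monoʳ-≤ (δ e) (δ-above-boundary x w (≢-same nx w≢e)
                                           (nearest-on-boundary e w w≢e δe)) ⟩
          δ e + δ x                    ∎

    profiles-disjoint : ∀ x y → cl x ≡ cl e → cl y ≢ cl e → dist G e x ≢ dist G e y
    profiles-disjoint x y cx cy d = m+1+n≰m (δ e) (begin
      δ e + 1           ≤⟨ +-monoʳ-≤ (δ e) (δ-positive y) ⟩
      δ e + δ y         ≡⟨ sym (profile-other y cy) ⟩
      dist G e y + 1    ≡⟨ cong (_+ 1) (sym d) ⟩
      dist G e x + 1    ≤⟨ +-monoʳ-≤ (dist G e x) (δ-positive x) ⟩
      dist G e x + δ x  ≡⟨ profile-same x cx ⟩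
      δ e               ∎)
      where open ≤-Reasoning

    profile-injective : ∀ x y → dist G e x ≡ dist G e y → x ≡ y
    profile-injective x y d with cl x ≟ cl e | cl y ≟ cl e
    ... | yes cx | yes cy = δ-injective x y (trans cx (sym cy))
          (+-cancelˡ-≡ (dist G e x) _ _ (trans (profile-same x cx)
            (sym (trans (cong (_+ δ y) d) (profile-same y cy)))))
    ... | no cx  | no cy  = δ-injective x y (≢-same cx cy)
          (+-cancelˡ-≡ (δ e) _ _ (trans (sym (profile-other x cx))
            (trans (cong (_+ 1) d) (profile-other y cy))))
    ... | yes cx | no cy  = contradiction d (profiles-disjoint x y cx cy)
    ... | no cx  | yes cy = contradiction (sym d) (profiles-disjoint y x cy cx)

  injective-profile : ∃ λ e → ∀ x y → dist G e x ≡ dist G e y → x ≡ y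
  injective-profile = e , Farthest.profile-injective e (λ x _ → δ-max x)
    where
      e : Fin n
      e = argmax δ (proj₁ (onto P fz)) (allFin n)
      δ-max : ∀ x → δ x ≤ δ e
      δ-max x = v≤f[argmax]⁺ _ (allFin n) (inj₂ (lose (∈-allFin x) ≤-refl))

module ProfilePath {n : ℕ} (G : Graph n) (conn : Connected G) (e : Fin n)
                   (inj : ∀ x y → dist G e x ≡ dist G e y → x ≡ y) where
  open Walks G
  open Metric G conn

  level : Fin n → Fin n
  level x = fromℕ< (dist<n e x)

  toℕ-level : ∀ x → toℕ (level x) ≡ dist G e x
  toℕ-level x = Fin.toℕ-fromℕ< (dist<n e x)

  level-injective : Injective _≡_ _≡_ level
  level-injective {x} {y} eq = inj x y (trans (sym (toℕ-level x)) (trans (cong toℕ eq) (toℕ-level y)))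

  atLevel : Fin n → Fin n
  atLevel i = proj₁ (injective⇒surjective level level-injective i)

  level-atLevel : ∀ i → level (atLevel i) ≡ i
  level-atLevel i = proj₂ (injective⇒surjective level level-injective i)

  numbering : Fin n ↔ Fin n
  numbering = mk↔ₛ′ atLevel level (λ x → level-injective (level-atLevel (level x))) level-atLevel

  adjacent⇒consecutive : ∀ x y → Adj G x y →
    suc (dist G e x) ≡ dist G e y ⊎ suc (dist G e y) ≡ dist G e x
  adjacent⇒consecutive x y a with <-cmp (dist G e x) (dist G e y)
  ... | tri≈ _ d _ = contradiction (subst (Adj G x) (sym (inj x y d)) a) (no-self-loop x)
  ... | tri< x<y _ _ = inj₁ (≤-antisym x<y (subst (dist G e y ≤_) (+-comm (dist G e x) 1)
                          (≤-trans (dist-triangle e x y) (+-monoʳ-≤ (dist G e x) (dist-adj a)))))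
  ... | tri> _ _ y<x = inj₂ (≤-antisym y<x (subst (dist G e x ≤_) (+-comm (dist G e y) 1)
                          (≤-trans (dist-triangle e y x) (+-monoʳ-≤ (dist G e y) (dist-adj (adj-sym a))))))

  consecutive⇒adjacent : ∀ x y → suc (dist G e x) ≡ dist G e y → Adj G x y
  consecutive⇒adjacent x y eq with predecessor e y (dist G e x) (sym eq)
  ... | z , a , dz = subst (λ u → Adj G u y) (inj z x dz) a

  levels⇔adjacent : ∀ x y →
    Adj G x y ⇔ (suc (dist G e x) ≡ dist G e y ⊎ suc (dist G e y) ≡ dist G e x)
  levels⇔adjacent x y = mk⇔ (adjacent⇒consecutive x y) λ
    { (inj₁ q) → consecutive⇒adjacent x y q
    ; (inj₂ q) → adj-sym (consecutive⇒adjacent y x q) }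

  isPath : IsPath G
  isPath = numbering , λ i j →
    subst₂ (λ a b → Adj G (atLevel i) (atLevel j) ⇔ (suc a ≡ b ⊎ suc b ≡ a))
      (key i) (key j) (levels⇔adjacent (atLevel i) (atLevel j))
    where
      key : ∀ i → dist G e (atLevel i) ≡ toℕ i
      key i = trans (sym (toℕ-level (atLevel i))) (cong toℕ (level-atLevel i))

injective-profile⇒path : ∀ {n} (G : Graph n) → Connected G →
  (∃ λ e → ∀ x y → dist G e x ≡ dist G e y → x ≡ y) → IsPath G
injective-profile⇒path G conn (e , inj) = ProfilePath.isPath G conn e inj

-- Step 5: on a path, numbered by `from σ`, the distance is the difference of
-- positions, so the partition {start vertex} ∪ {the rest} strongly resolves.
module PathPartition {m : ℕ} (G : Graph (suc (suc m))) (conn : Connected G)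
                     (σ : Fin (suc (suc m)) ↔ Fin (suc (suc m)))
                     (path : ∀ i j → Adj G (Inverse.to σ i) (Inverse.to σ j) ⇔ PathAdj i j) where
  open Walks G
  open Metric G conn
  open Inverse σ using (to; from; strictlyInverseˡ; strictlyInverseʳ)

  pos : Fin (suc (suc m)) → ℕ
  pos x = toℕ (from x)

  pos-to : ∀ i → pos (to i) ≡ toℕ i
  pos-to i = cong toℕ (strictlyInverseʳ i)

  pos-injective : ∀ {x y} → pos x ≡ pos y → x ≡ y
  pos-injective {x} {y} eq =
    trans (sym (strictlyInverseˡ x)) (trans (cong to (Fin.toℕ-injective eq)) (strictlyInverseˡ y))

  pos-step : ∀ {x y} → Adj G x y → pos y ≤ suc (pos x)
  pos-step {x} {y} a with Equivalence.to (path (from x) (from y))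
                            (subst₂ (Adj G) (sym (strictlyInverseˡ x)) (sym (strictlyInverseˡ y)) a)
  ... | inj₁ up   = ≤-reflexive (sym up)
  ... | inj₂ down = ≤-trans (n≤1+n _) (≤-trans (≤-reflexive down) (n≤1+n _))

  pos-walk : ∀ {x y L} → Walk G x y L → pos y ≤ L + pos x
  pos-walk []                = ≤-refl
  pos-walk {x} {L = suc L} (a ∷ w) =
    ≤-trans (pos-walk w) (≤-trans (+-monoʳ-≤ L (pos-step a)) (≤-reflexive (+-suc L (pos x))))

  forward : ∀ x → suc (pos x) < suc (suc m) → ∃ λ z → Adj G x z × pos z ≡ suc (pos x)
  forward x lt = to (fromℕ< lt) , adjacent , trans (pos-to (fromℕ< lt)) (Fin.toℕ-fromℕ< lt)
    where
      adjacent : Adj G x (to (fromℕ< lt))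
      adjacent = subst (λ u → Adj G u (to (fromℕ< lt))) (strictlyInverseˡ x)
        (Equivalence.from (path (from x) (fromℕ< lt)) (inj₁ (sym (Fin.toℕ-fromℕ< lt))))

  -- Hence d steps forward reach the vertex d positions further, and no
  -- shorter walk does: the distance is the difference of positions.
  climb : ∀ d x y → pos y ≡ d + pos x → Walk G x y d
  climb zero    x y eq = subst (λ v → Walk G x v 0) (pos-injective (sym eq)) []
  climb (suc d) x y eq with forward x (≤-<-trans below-y (Fin.toℕ<n (from y)))
    where
      below-y : suc (pos x) ≤ pos y
      below-y = ≤-trans (m≤n+m (suc (pos x)) d) (≤-reflexive (trans (+-suc d (pos x)) (sym eq)))
  ... | z , a , pz = a ∷ climb d z y (trans eq (trans (sym (+-suc d (pos x))) (cong (d +_) (sym pz))))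

  dist-along : ∀ d x y → pos y ≡ d + pos x → dist G x y ≡ d
  dist-along d x y eq = ≤-antisym (dist-≤ (climb d x y eq))
    (+-cancelʳ-≤ (pos x) d _ (subst (_≤ dist G x y + pos x) eq (pos-walk (geodesic x y))))

  dist-pos : ∀ {x y} → pos y ≤ pos x → pos x ≡ dist G x y + pos y
  dist-pos {x} {y} le = trans (sym (m∸n+n≡m le))
    (cong (_+ pos y) (sym (trans (dist-sym x y) (dist-along _ y x (sym (m∸n+n≡m le))))))

  startLabel : ℕ → Fin 2
  startLabel zero    = fz
  startLabel (suc _) = fs fz

  startLabel≡fz : ∀ k → startLabel k ≡ fz → k ≡ 0
  startLabel≡fz zero    _ = refl
  startLabel≡fz (suc k) ()

  partition : Partition G 2
  partition = record { cls = λ v → startLabel (pos v) ; onto = onto′ }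
    where
      onto′ : ∀ i → ∃ λ v → startLabel (pos v) ≡ i
      onto′ fz      = to fz , cong startLabel (pos-to fz)
      onto′ (fs fz) = to (fs fz) , cong startLabel (pos-to (fs fz))

  open Classes partition

  Start : VSet (suc (suc m))
  Start = classSet partition fz

  distSet-Start : ∀ z → distSet G z Start ≡ pos z
  distSet-Start z with distSet-attained z Start (∈class (cong startLabel (pos-to fz)))
  ... | w , w∈ , eq = trans eq (trans (dist-sym z w) (dist-along (pos z) w z
        (sym (trans (cong (pos z +_) (startLabel≡fz _ (∈class⁻ w∈))) (+-identityʳ (pos z))))))

  off-start : ∀ x y → x ≢ y → startLabel (pos x) ≡ startLabel (pos y) → startLabel (pos x) ≢ fz
  off-start x y ne same at-start = ne (pos-injective
    (trans (startLabel≡fz _ at-start) (sym (startLabel≡fz _ (trans (sym same) at-start)))))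

  Start-resolves : ∀ x y → pos x ≡ dist G x y + pos y →
    distSet G x Start ≡ dist G x y + distSet G y Start
  Start-resolves x y eq =
    trans (distSet-Start x) (trans eq (cong (dist G x y +_) (sym (distSet-Start y))))

  strong : IsStrongResolvingPartition G partition
  strong x y ne same = fz , ∉class (off-start x y ne same)
                          , ∉class (off-start y x (λ q → ne (sym q)) (sym same))
                          , Sum.map (λ le → Start-resolves x y (dist-pos le))
                                    (λ le → Start-resolves y x (dist-pos le))
                                    (≤-total (pos y) (pos x))

theorem19 : (n : ℕ) → 2 ≤ n → (G : Graph n) → Connected G →
    PdsEq G 2 ⇔ IsPath G
theorem19 (suc zero)    (s≤s ()) G conn
theorem19 (suc (suc m)) _        G conn = mk⇔ pd2⇒path path⇒pd2
  where
    pd2⇒path : PdsEq G 2 → IsPath G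
    pd2⇒path ((P , srp) , _) = injective-profile⇒path G conn (TwoClasses.injective-profile G conn P srp)

    path⇒pd2 : IsPath G → PdsEq G 2
    path⇒pd2 (σ , path) = (partition , strong) , pd-lower G
      where open PathPartition G conn σ path
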